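{- Up to equivalence there are exactly three complete standard systems: $\mathbf{GS1p}$, $\mathbf{Pp}$ and $\mathbf{Np}$. That is, each of these three is a complete standard system, and every complete standard system is equivalent to one of them.
   Context: Formulas are built from literals (propositional variables $P$ and their complements $\bar P$) using $\wedge$ and $\vee$. Negation satisfies $\neg P=\bar P$ and is extended by De Morgan's laws. A sequent is a nonempty finite multiset of formulas. A comma denotes multiset union, and $\Gamma,\Delta,\Sigma$ denote possibly empty multisets. A formula is valid if it evaluates to $1$ under every $0/1$-assignment. Rules: - Axiom: infer $P,\neg P$ from no premises. - $(\&)$: from $\Gamma,A$ and $\Gamma,B$ infer $\Gamma,A\wedge B$. - $(\otimes)$: from $\Delta,A$ and $\Sigma,B$ infer $\Delta,\Sigma,A\wedge B$. - $(\oplus)$: consists of both $(\oplus_1)$ and $(\oplus_2)$, where $(\oplus_i)$ infers $\Gamma,A_1\vee A_2$ from $\Gamma,A_i$. - $(\mathrm{par})$: from $\Gamma,A,B$ infer $\Gamma,A\vee B$. - $(\mathsf W)$: from $\Gamma$ infer $\Gamma,A$. - $(\mathsf C)$: from $\Gamma,A,A$ infer $\Gamma,A$. A standard system is the axiom together with any subset of $\{(\&),(\otimes),(\oplus),(\mathrm{par}),(\mathsf W),(\mathsf C)\}$. The named systems are: - $\mathbf{GS1p}$ = axiom + $(\&),(\oplus),(\mathsf W),(\mathsf C)$; - $\mathbf{Pp}$ = axiom + $(\otimes),(\oplus),(\mathsf C)$; - $\mathbf{Np}$ = axiom + $(\&),(\mathrm{par}),(\mathsf W)$. A rule is derivable in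 $S$ if, for every instance of it, the conclusion is derivable in $S$ from its premises used as extra leaves. $S$ contains $T$ if every rule of $T$ is derivable in $S$. Two systems are equivalent if each contains the other. A system is complete if every valid formula is derivable in it. -}

module Defs where

open import Data.Nat using (ℕ)
open import Data.Bool using (Bool; true; false; not; _∧_; _∨_)
open import Data.List using (List; []; _∷_; _++_)
open import Data.List.Membership.Propositional using (_∈_)
open import Data.List.Relation.Binary.Permutation.Propositional using (_↭_)
open import Data.Empty using (⊥)
open import Data.Product using (_×_)
open import Data.Sum using (_⊎_)
open import Relation.Binary.PropositionalEquality using (_≡_; _≢_)

data Literal : Set where
  pos : ℕ → Literal
  neg : ℕ → Literal

data Formula : Set where
  lit  : Literal → Formula
  _∧ᶠ_ : Formula → Formula → Formula
  _∨ᶠ_ : Formula → Formula → Formula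

¬ᶠ : Formula → Formula
¬ᶠ (lit (pos n)) = lit (neg n)
¬ᶠ (lit (neg n)) = lit (pos n)
¬ᶠ (A ∧ᶠ B) = ¬ᶠ A ∨ᶠ ¬ᶠ B
¬ᶠ (A ∨ᶠ B) = ¬ᶠ A ∧ᶠ ¬ᶠ B

evalLit : (ℕ → Bool) → Literal → Bool
evalLit v (pos n) = v n
evalLit v (neg n) = not (v n)

eval : (ℕ → Bool) → Formula → Bool
eval v (lit l) = evalLit v l
eval v (A ∧ᶠ B) = eval v A ∧ eval v B
eval v (A ∨ᶠ B) = eval v A ∨ eval v B

Valid : Formula → Set
Valid A = (v : ℕ → Bool) → eval v A ≡ true

-- Sequents: nonempty finite multisets of formulas, represented by lists
-- taken up to permutation (the derivation relation is closed under _↭_).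
-- A comma "Γ , A" is rendered as A ∷ Γ (or Γ ++ Δ for Γ , Δ).

Sequent : Set
Sequent = List Formula

data Rule : Set where
  &R ⊗R ⊕R parR WR CR : Rule

-- A standard system: the axiom together with a subset of the rules.
System : Set
System = Rule → Bool

_∈ˢ_ : Rule → System → Set
r ∈ˢ S = S r ≡ true

data Der (S : System) (H : Sequent → Set) : Sequent → Set where
  leaf : ∀ {Γ} → H Γ → Der S H Γ
  -- multiset identification
  perm : ∀ {Γ Δ} → Γ ↭ Δ → Der S H Γ → Der S H Δ
  ax   : ∀ n → Der S H (lit (pos n) ∷ ¬ᶠ (lit (pos n)) ∷ [])
  with& : &R ∈ˢ S → ∀ {Γ A B} → Der S H (A ∷ Γ) → Der S H (B ∷ Γ)
        → Der S H ((A ∧ᶠ B) ∷ Γ)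
  with⊗ : ⊗R ∈ˢ S → ∀ {Δ Σ A B} → Der S H (A ∷ Δ) → Der S H (B ∷ Σ)
        → Der S H ((A ∧ᶠ B) ∷ (Δ ++ Σ))
  with⊕₁ : ⊕R ∈ˢ S → ∀ {Γ A B} → Der S H (A ∷ Γ) → Der S H ((A ∨ᶠ B) ∷ Γ)
  with⊕₂ : ⊕R ∈ˢ S → ∀ {Γ A B} → Der S H (B ∷ Γ) → Der S H ((A ∨ᶠ B) ∷ Γ)
  withPar : parR ∈ˢ S → ∀ {Γ A B} → Der S H (A ∷ B ∷ Γ)
          → Der S H ((A ∨ᶠ B) ∷ Γ)
  withW : WR ∈ˢ S → ∀ {Γ A} → Γ ≢ [] → Der S H Γ → Der S H (A ∷ Γ)
  withC : CR ∈ˢ S → ∀ {Γ A} → Der S H (A ∷ A ∷ Γ) → Der S H (A ∷ Γ)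

data Instance : Rule → List Sequent → Sequent → Set where
  i& : ∀ Γ A B → Instance &R ((A ∷ Γ) ∷ (B ∷ Γ) ∷ []) ((A ∧ᶠ B) ∷ Γ)
  i⊗ : ∀ Δ Σ A B → Instance ⊗R ((A ∷ Δ) ∷ (B ∷ Σ) ∷ []) ((A ∧ᶠ B) ∷ (Δ ++ Σ))
  i⊕₁ : ∀ Γ A B → Instance ⊕R ((A ∷ Γ) ∷ []) ((A ∨ᶠ B) ∷ Γ)
  i⊕₂ : ∀ Γ A B → Instance ⊕R ((B ∷ Γ) ∷ []) ((A ∨ᶠ B) ∷ Γ)
  iPar : ∀ Γ A B → Instance parR ((A ∷ B ∷ Γ) ∷ []) ((A ∨ᶠ B) ∷ Γ)
  iW : ∀ Γ A → Γ ≢ [] → Instance WR (Γ ∷ []) (A ∷ Γ)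
  iC : ∀ Γ A → Instance CR ((A ∷ A ∷ Γ) ∷ []) (A ∷ Γ)

DerivableRule : System → Rule → Set
DerivableRule S r = ∀ prems concl → Instance r prems concl
                  → Der S (λ Γ → Γ ∈ prems) concl

-- S contains T (the axiom is common to all standard systems).
Contains : System → System → Set
Contains S T = ∀ r → r ∈ˢ T → DerivableRule S r

Equivalent : System → System → Set
Equivalent S T = Contains S T × Contains T S

Complete : System → Set
Complete S = ∀ A → Valid A → Der S (λ _ → ⊥) (A ∷ [])

GS1p : System
GS1p &R = true
GS1p ⊗R = false
GS1p ⊕R = true
GS1p parR = false
GS1p WR = true
GS1p CR = true

Pp : System
Pp &R = false
Pp ⊗R = true
Pp ⊕R = true
Pp parR = false
Pp WR = false
Pp CR = true

Np : System
Np &R = true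
Np ⊗R = false
Np ⊕R = false
Np parR = true
Np WR = true
Np CR = false

-- Completeness of the three systems is the usual bottom-up decomposition of a valid
-- sequent: ∧ is split by & (in GS1p and Np) and ∨ by par (derivable from ⊕ and C in
-- GS1p), until a sequent of literals is reached; it contains a complementary pair, and W
-- weakens the axiom to the whole sequent. Pp has no W, so there one derives only a subset
-- of the sequent, using contraction to merge copies and ⊗ in place of &.
--
-- Conversely, a finite matrix (a commutative monoid interpreting the comma, operations
-- interpreting ∧ and ∨, and designated values) in which every rule but r₁ and r₂ preserves
-- designation, while some tautology is undesignated, shows that a complete system contains
-- r₁ or r₂. Six such matrices give: & or ⊗, ⊕ or par, C or par, C or &, W or ⊕, W or ⊗;
-- an inversion argument gives W or C. With W and C the system is equivalent to GS1p; with C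
-- but not W it has ⊗ and ⊕, hence is equivalent to Pp; with W but not C it has & and par,
-- hence is equivalent to Np. The equivalences rest on ⊗ being derivable from & and W, &
-- from ⊗ and C, ⊕ from par and W, and par from ⊕ and C.

module Submission where

open import Defs
open import Algebra.Core using (Op₂)
open import Algebra.Definitions using (Commutative; Associative; LeftIdentity)
open import Algebra.Structures using (IsCommutativeMonoid)
open import Algebra.Structures.Biased using (isCommutativeMonoidˡ)
open import Data.Bool using (Bool; true; false; T; if_then_else_; _∧_; _∨_)
open import Data.Bool.Properties using (not-¬; T-≡; T-∧; T-∨)
open import Data.Empty using (⊥; ⊥-elim)
open import Data.Fin using (Fin; _≟_)
open import Data.Fin.Patterns using (0F; 1F; 2F; 3F; 4F)
open import Data.Fin.Properties using (all?)
open import Data.List using ([]; _∷_; _++_; filter; foldr; map)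
open import Data.List.Properties using (++-assoc; ++-conicalʳ; ++-identityʳ; filter-reject)
open import Data.List.Membership.Propositional using (_∈_; _∉_; find)
open import Data.List.Membership.Propositional.Properties using (∈-∃++; ∈-map⁺; ∈-++⁻; ∈-filter⁻)
open import Data.List.Relation.Binary.Permutation.Propositional
  using (_↭_; prep; swap; ↭-refl; ↭-reflexive; ↭-sym; ↭-trans; ↭⇒↭ₛ)
open import Data.List.Relation.Binary.Permutation.Propositional.Properties
  using (shift; ++-comm; filter-↭; map⁺; Any-resp-↭; ∈-resp-↭; ↭-length; drop-∷)
  renaming (++-identityʳ to ↭-++-identityʳ)
open import Data.List.Relation.Binary.Permutation.Setoid.Properties using (foldr-commMonoid)
open import Data.List.Relation.Binary.Subset.Propositional using (_⊆_)
open import Data.List.Relation.Binary.Subset.Propositional.Properties using (⊆[]⇒≡[])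
open import Data.List.Relation.Unary.Any using (Any; here; there)
import Data.List.Relation.Unary.Any.Properties as Any
open import Data.Nat using (ℕ; suc; _+_; _<_; s≤s; _≡ᵇ_)
import Data.Nat as ℕ
open import Data.Nat.Induction using (<-wellFounded)
open import Data.Nat.Properties using (≤-refl; ≤-reflexive; +-assoc; +-monoˡ-≤; m≤m+n; m≤n+m)
open import Data.Product using (∃; _×_; _,_; proj₁; proj₂; uncurry)
open import Data.Sum using (_⊎_; inj₁; inj₂; [_,_]′; fromInj₂)
open import Data.Vec using (Vec; []; _∷_; lookup)
open import Function using (_∘_; _on_; case_of_; Equivalence)
open import Induction.WellFounded using (Acc; acc)
open import Relation.Binary.Construct.On using () renaming (wellFounded to on-wellFounded)
open import Relation.Binary.Definitions using (DecidableEquality)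
open import Relation.Binary.PropositionalEquality
  using (_≡_; _≢_; refl; sym; trans; cong; cong₂; subst; setoid)
open import Relation.Binary.PropositionalEquality.Algebra using (isMagma)
open import Relation.Nullary using (¬_; Dec; yes; no; does; ¬?; contradiction; contradiction₂)
open import Relation.Nullary.Decidable using (True; toWitness; map′; _×-dec_; _⊎-dec_; _→-dec_)
open import Relation.Nullary.Decidable.Core using (T?)

_≟ˡ_ : DecidableEquality Literal
pos m ≟ˡ pos n = map′ (cong pos) (λ { refl → refl }) (m ℕ.≟ n)
pos _ ≟ˡ neg _ = no λ ()
neg _ ≟ˡ pos _ = no λ ()
neg m ≟ˡ neg n = map′ (cong neg) (λ { refl → refl }) (m ℕ.≟ n)

_≟ᶠ_ : DecidableEquality Formula
lit l    ≟ᶠ lit m    = map′ (cong lit) (λ { refl → refl }) (l ≟ˡ m)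
(A ∧ᶠ B) ≟ᶠ (C ∧ᶠ D) = map′ (uncurry (cong₂ _∧ᶠ_)) (λ { refl → refl , refl }) (A ≟ᶠ C ×-dec B ≟ᶠ D)
(A ∨ᶠ B) ≟ᶠ (C ∨ᶠ D) = map′ (uncurry (cong₂ _∨ᶠ_)) (λ { refl → refl , refl }) (A ≟ᶠ C ×-dec B ≟ᶠ D)
lit _    ≟ᶠ (_ ∧ᶠ _) = no λ ()
lit _    ≟ᶠ (_ ∨ᶠ _) = no λ ()
(_ ∧ᶠ _) ≟ᶠ lit _    = no λ ()
(_ ∧ᶠ _) ≟ᶠ (_ ∨ᶠ _) = no λ ()
(_ ∨ᶠ _) ≟ᶠ lit _    = no λ ()
(_ ∨ᶠ _) ≟ᶠ (_ ∧ᶠ _) = no λ ()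

open import Data.List.Membership.DecPropositional _≟ˡ_ using () renaming (_∈?_ to _∈ˡ?_)
open import Data.List.Membership.DecPropositional _≟ᶠ_ using () renaming (_∈?_ to _∈ᶠ?_)

_∖_ : Sequent → Formula → Sequent
Γ ∖ A = filter (λ B → ¬? (B ≟ᶠ A)) Γ

∈⇒↭ : ∀ {A : Formula} {Γ} → A ∈ Γ → ∃ λ Γ′ → Γ ↭ A ∷ Γ′
∈⇒↭ {A} A∈Γ with ∈-∃++ A∈Γ
... | Γ₁ , Γ₂ , refl = Γ₁ ++ Γ₂ , shift A Γ₁ Γ₂

-- Derived rules

module _ {S : System} {H : Sequent → Set} where

  weaken-++ : WR ∈ˢ S → ∀ Θ {Γ} → Γ ≢ [] → Der S H Γ → Der S H (Θ ++ Γ)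
  weaken-++ W∈S []      Γ≢[] d = d
  weaken-++ W∈S (_ ∷ Θ) Γ≢[] d = withW W∈S (Γ≢[] ∘ ++-conicalʳ Θ _) (weaken-++ W∈S Θ Γ≢[] d)

  axiom-weakened : WR ∈ˢ S → ∀ {n Γ} → lit (pos n) ∈ Γ → lit (neg n) ∈ Γ → Der S H Γ
  axiom-weakened W∈S pos∈Γ neg∈Γ with ∈⇒↭ pos∈Γ
  ... | Γ₁ , Γ↭ with ∈-resp-↭ Γ↭ neg∈Γ
  ... | there neg∈Γ₁ with ∈⇒↭ neg∈Γ₁
  ... | Γ₂ , Γ₁↭ = perm (↭-sym (↭-trans Γ↭ (prep _ Γ₁↭)))
                     (perm (++-comm Γ₂ _) (weaken-++ W∈S Γ₂ (λ ()) (ax _)))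

  contract-++ : CR ∈ˢ S → ∀ Δ Γ → Der S H (Δ ++ Γ ++ Γ) → Der S H (Δ ++ Γ)
  contract-++ C∈S Δ []      d = d
  contract-++ C∈S Δ (A ∷ Γ) d =
    perm (↭-sym (shift A Δ Γ)) (contract-++ C∈S (A ∷ Δ) Γ
      (subst (λ Ξ → Der S H (A ∷ Ξ)) (++-assoc Δ Γ Γ) (withC C∈S (perm copies-to-front d))))
    where
    copies-to-front : Δ ++ A ∷ Γ ++ A ∷ Γ ↭ A ∷ A ∷ (Δ ++ Γ) ++ Γ
    copies-to-front = ↭-trans (shift A Δ (Γ ++ A ∷ Γ))
      (prep A (subst (_↭ A ∷ (Δ ++ Γ) ++ Γ) (++-assoc Δ Γ (A ∷ Γ)) (shift A (Δ ++ Γ) Γ)))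

  contract-copies : CR ∈ˢ S → ∀ {A} Γ Θ → Der S H (A ∷ Γ ++ Θ) → Der S H (A ∷ Γ ∖ A ++ Θ)
  contract-copies C∈S     []      Θ d = d
  contract-copies C∈S {A} (B ∷ Γ) Θ d with B ≟ᶠ A
  ... | yes refl = contract-copies C∈S Γ Θ (withC C∈S d)
  ... | no  _    = perm (prep A (shift B (Γ ∖ A) Θ))
                     (contract-copies C∈S Γ (B ∷ Θ) (perm (prep A (↭-sym (shift B Γ Θ))) d))

  isolate : CR ∈ˢ S → ∀ {A Γ} → A ∈ Γ → Der S H Γ → Der S H (A ∷ Γ ∖ A)
  isolate C∈S {A} {Γ} A∈Γ d with ∈⇒↭ A∈Γ
  ... | Γ′ , Γ↭ = perm (prep A (↭-trans (↭-++-identityʳ (Γ′ ∖ A)) Γ′∖A↭Γ∖A))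
                    (contract-copies C∈S Γ′ [] (perm (↭-trans Γ↭ (prep A (↭-sym (↭-++-identityʳ Γ′)))) d))
    where
    Γ′∖A↭Γ∖A : Γ′ ∖ A ↭ Γ ∖ A
    Γ′∖A↭Γ∖A = subst (_↭ Γ ∖ A) (filter-reject (λ B → ¬? (B ≟ᶠ A)) (λ A≢A → A≢A refl))
                 (filter-↭ (λ B → ¬? (B ≟ᶠ A)) (↭-sym Γ↭))

  &-by-⊗C : ⊗R ∈ˢ S → CR ∈ˢ S → ∀ {Γ A B} → Der S H (A ∷ Γ) → Der S H (B ∷ Γ) → Der S H ((A ∧ᶠ B) ∷ Γ)
  &-by-⊗C ⊗∈S C∈S {Γ} {A} {B} d₁ d₂ = contract-++ C∈S ((A ∧ᶠ B) ∷ []) Γ (with⊗ ⊗∈S d₁ d₂)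

  ⊗-by-&W : &R ∈ˢ S → WR ∈ˢ S → ∀ {Δ Θ A B} → Der S H (A ∷ Δ) → Der S H (B ∷ Θ)
          → Der S H ((A ∧ᶠ B) ∷ Δ ++ Θ)
  ⊗-by-&W &∈S W∈S {Δ} {Θ} {A} {B} d₁ d₂ = with& &∈S
    (perm (↭-trans (shift A Θ Δ) (prep A (++-comm Θ Δ))) (weaken-++ W∈S Θ (λ ()) d₁))
    (perm (shift B Δ Θ) (weaken-++ W∈S Δ (λ ()) d₂))

  ⊕₁-by-parW : parR ∈ˢ S → WR ∈ˢ S → ∀ {Γ A B} → Der S H (A ∷ Γ) → Der S H ((A ∨ᶠ B) ∷ Γ)
  ⊕₁-by-parW par∈S W∈S d = withPar par∈S (perm (swap _ _ ↭-refl) (withW W∈S (λ ()) d))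

  ⊕₂-by-parW : parR ∈ˢ S → WR ∈ˢ S → ∀ {Γ A B} → Der S H (B ∷ Γ) → Der S H ((A ∨ᶠ B) ∷ Γ)
  ⊕₂-by-parW par∈S W∈S d = withPar par∈S (withW W∈S (λ ()) d)

  par-by-⊕C : ⊕R ∈ˢ S → CR ∈ˢ S → ∀ {Γ A B} → Der S H (A ∷ B ∷ Γ) → Der S H ((A ∨ᶠ B) ∷ Γ)
  par-by-⊕C ⊕∈S C∈S d = withC C∈S (with⊕₂ ⊕∈S (perm (swap _ _ ↭-refl) (with⊕₁ ⊕∈S d)))

module _ {S : System} where

  premise₁ : ∀ {Γ Γs} → Der S (_∈ Γ ∷ Γs) Γ
  premise₁ = leaf (here refl)

  premise₂ : ∀ {Γ Δ Γs} → Der S (_∈ Γ ∷ Δ ∷ Γs) Δ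
  premise₂ = leaf (there (here refl))

  rule-derivable : ∀ {r} → r ∈ˢ S → DerivableRule S r
  rule-derivable r∈S _ _ (i& _ _ _)    = with& r∈S premise₁ premise₂
  rule-derivable r∈S _ _ (i⊗ _ _ _ _)  = with⊗ r∈S premise₁ premise₂
  rule-derivable r∈S _ _ (i⊕₁ _ _ _)   = with⊕₁ r∈S premise₁
  rule-derivable r∈S _ _ (i⊕₂ _ _ _)   = with⊕₂ r∈S premise₁
  rule-derivable r∈S _ _ (iPar _ _ _)  = withPar r∈S premise₁
  rule-derivable r∈S _ _ (iW _ _ Γ≢[]) = withW r∈S Γ≢[] premise₁
  rule-derivable r∈S _ _ (iC _ _)      = withC r∈S premise₁

  &-derivable-⊗C : ⊗R ∈ˢ S → CR ∈ˢ S → DerivableRule S &R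
  &-derivable-⊗C ⊗∈S C∈S _ _ (i& _ _ _) = &-by-⊗C ⊗∈S C∈S premise₁ premise₂

  ⊗-derivable-&W : &R ∈ˢ S → WR ∈ˢ S → DerivableRule S ⊗R
  ⊗-derivable-&W &∈S W∈S _ _ (i⊗ _ _ _ _) = ⊗-by-&W &∈S W∈S premise₁ premise₂

  ⊕-derivable-parW : parR ∈ˢ S → WR ∈ˢ S → DerivableRule S ⊕R
  ⊕-derivable-parW par∈S W∈S _ _ (i⊕₁ _ _ _) = ⊕₁-by-parW par∈S W∈S premise₁
  ⊕-derivable-parW par∈S W∈S _ _ (i⊕₂ _ _ _) = ⊕₂-by-parW par∈S W∈S premise₁

  par-derivable-⊕C : ⊕R ∈ˢ S → CR ∈ˢ S → DerivableRule S parR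
  par-derivable-⊕C ⊕∈S C∈S _ _ (iPar _ _ _) = par-by-⊕C ⊕∈S C∈S premise₁

GS1p-contains : ∀ S → Contains GS1p S
GS1p-contains _ &R   _ = rule-derivable refl
GS1p-contains _ ⊗R   _ = ⊗-derivable-&W refl refl
GS1p-contains _ ⊕R   _ = rule-derivable refl
GS1p-contains _ parR _ = par-derivable-⊕C refl refl
GS1p-contains _ WR   _ = rule-derivable refl
GS1p-contains _ CR   _ = rule-derivable refl

Pp-contains : ∀ {S} → ¬ WR ∈ˢ S → Contains Pp S
Pp-contains _   &R   _   = &-derivable-⊗C refl refl
Pp-contains _   ⊗R   _   = rule-derivable refl
Pp-contains _   ⊕R   _   = rule-derivable refl
Pp-contains _   parR _   = par-derivable-⊕C refl refl
Pp-contains W∉S WR   W∈S = contradiction W∈S W∉S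
Pp-contains _   CR   _   = rule-derivable refl

Np-contains : ∀ {S} → ¬ CR ∈ˢ S → Contains Np S
Np-contains _   &R   _   = rule-derivable refl
Np-contains _   ⊗R   _   = ⊗-derivable-&W refl refl
Np-contains _   ⊕R   _   = ⊕-derivable-parW refl refl
Np-contains _   parR _   = rule-derivable refl
Np-contains _   WR   _   = rule-derivable refl
Np-contains C∉S CR   C∈S = contradiction C∈S C∉S

contains-GS1p : ∀ {S} → WR ∈ˢ S → CR ∈ˢ S → &R ∈ˢ S ⊎ ⊗R ∈ˢ S → ⊕R ∈ˢ S ⊎ parR ∈ˢ S
              → Contains S GS1p
contains-GS1p _   C∈S &⊎⊗ _     &R   _ = [ rule-derivable , (λ ⊗∈S → &-derivable-⊗C ⊗∈S C∈S) ]′ &⊎⊗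
contains-GS1p W∈S _   _   ⊕⊎par ⊕R   _ = [ rule-derivable , (λ par∈S → ⊕-derivable-parW par∈S W∈S) ]′ ⊕⊎par
contains-GS1p W∈S _   _   _     WR   _ = rule-derivable W∈S
contains-GS1p _   C∈S _   _     CR   _ = rule-derivable C∈S
contains-GS1p _   _   _   _     ⊗R   ()
contains-GS1p _   _   _   _     parR ()

contains-Pp : ∀ {S} → ⊗R ∈ˢ S → ⊕R ∈ˢ S → CR ∈ˢ S → Contains S Pp
contains-Pp ⊗∈S _   _   ⊗R   _ = rule-derivable ⊗∈S
contains-Pp _   ⊕∈S _   ⊕R   _ = rule-derivable ⊕∈S
contains-Pp _   _   C∈S CR   _ = rule-derivable C∈S
contains-Pp _   _   _   &R   ()
contains-Pp _   _   _   parR ()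
contains-Pp _   _   _   WR   ()

contains-Np : ∀ {S} → &R ∈ˢ S → parR ∈ˢ S → WR ∈ˢ S → Contains S Np
contains-Np &∈S _     _   &R   _ = rule-derivable &∈S
contains-Np _   par∈S _   parR _ = rule-derivable par∈S
contains-Np _   _     W∈S WR   _ = rule-derivable W∈S
contains-Np _   _     _   ⊗R   ()
contains-Np _   _     _   ⊕R   ()
contains-Np _   _     _   CR   ()

-- Matrix semantics

record Matrix : Set₁ where
  infixr 5 _·_
  infixl 6 _⊔_
  infixl 7 _⊓_
  field
    Carrier             : Set
    _·_                 : Op₂ Carrier
    ε                   : Carrier
    _⊓_ _⊔_             : Op₂ Carrier
    Designated          : Carrier → Set
    isCommutativeMonoid : IsCommutativeMonoid _≡_ _·_ ε

module _ (M : Matrix) where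
  open Matrix M

  Validates : Rule → Set
  Validates &R   = ∀ a b γ → Designated (a · γ) → Designated (b · γ) → Designated (a ⊓ b · γ)
  Validates ⊗R   = ∀ a b δ θ → Designated (a · δ) → Designated (b · θ) → Designated (a ⊓ b · δ · θ)
  Validates ⊕R   = ∀ a b γ → Designated (a · γ) ⊎ Designated (b · γ) → Designated (a ⊔ b · γ)
  Validates parR = ∀ a b γ → Designated (a · b · γ) → Designated (a ⊔ b · γ)
  Validates WR   = ∀ a γ → Designated γ → Designated (a · γ)
  Validates CR   = ∀ a γ → Designated (a · a · γ) → Designated (a · γ)

module Semantics (M : Matrix) (ι : Literal → Matrix.Carrier M) where
  open Matrix M
  open IsCommutativeMonoid isCommutativeMonoid using (assoc; identityˡ)

  ⟦_⟧ : Formula → Carrier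
  ⟦ lit l ⟧   = ι l
  ⟦ A ∧ᶠ B ⟧ = ⟦ A ⟧ ⊓ ⟦ B ⟧
  ⟦ A ∨ᶠ B ⟧ = ⟦ A ⟧ ⊔ ⟦ B ⟧

  ⟦_⟧ˢ : Sequent → Carrier
  ⟦ Γ ⟧ˢ = foldr _·_ ε (map ⟦_⟧ Γ)

  ⟦⟧ˢ-↭ : ∀ {Γ Δ} → Γ ↭ Δ → ⟦ Γ ⟧ˢ ≡ ⟦ Δ ⟧ˢ
  ⟦⟧ˢ-↭ Γ↭Δ = foldr-commMonoid (setoid Carrier) isCommutativeMonoid (↭⇒↭ₛ (map⁺ ⟦_⟧ Γ↭Δ))

  ⟦⟧ˢ-++ : ∀ Δ Θ → ⟦ Δ ++ Θ ⟧ˢ ≡ ⟦ Δ ⟧ˢ · ⟦ Θ ⟧ˢ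
  ⟦⟧ˢ-++ []      Θ = sym (identityˡ ⟦ Θ ⟧ˢ)
  ⟦⟧ˢ-++ (A ∷ Δ) Θ = trans (cong (⟦ A ⟧ ·_) (⟦⟧ˢ-++ Δ Θ)) (sym (assoc ⟦ A ⟧ ⟦ Δ ⟧ˢ ⟦ Θ ⟧ˢ))

  AxiomsDesignated : Set
  AxiomsDesignated = ∀ n → Designated ⟦ lit (pos n) ∷ lit (neg n) ∷ [] ⟧ˢ

  module _ {S} (rules-valid : ∀ r → r ∈ˢ S → Validates M r) (axioms : AxiomsDesignated) where

    sound : ∀ {Γ} → Der S (λ _ → ⊥) Γ → Designated ⟦ Γ ⟧ˢ
    sound (leaf ())
    sound (perm Γ↭Δ d)              = subst Designated (⟦⟧ˢ-↭ Γ↭Δ) (sound d)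
    sound (ax n)                    = axioms n
    sound (with& r∈S d₁ d₂)         = rules-valid &R r∈S _ _ _ (sound d₁) (sound d₂)
    sound (with⊗ r∈S {Δ} {Θ} d₁ d₂) = subst (λ x → Designated (_ · x)) (sym (⟦⟧ˢ-++ Δ Θ))
                                        (rules-valid ⊗R r∈S _ _ _ _ (sound d₁) (sound d₂))
    sound (with⊕₁ r∈S d)            = rules-valid ⊕R r∈S _ _ _ (inj₁ (sound d))
    sound (with⊕₂ r∈S d)            = rules-valid ⊕R r∈S _ _ _ (inj₂ (sound d))
    sound (withPar r∈S d)           = rules-valid parR r∈S _ _ _ (sound d)
    sound (withW r∈S _ d)           = rules-valid WR r∈S _ _ (sound d)
    sound (withC r∈S d)             = rules-valid CR r∈S _ _ (sound d)

isCommutativeMonoid? : ∀ {n} (_·_ : Op₂ (Fin (suc n))) → Dec (IsCommutativeMonoid _≡_ _·_ 0F)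
isCommutativeMonoid? _·_ = map′ fromLaws toLaws (comm? ×-dec assoc? ×-dec identityˡ?)
  where
  Laws : Set
  Laws = Commutative _≡_ _·_ × Associative _≡_ _·_ × LeftIdentity _≡_ 0F _·_

  comm? : Dec (Commutative _≡_ _·_)
  comm? = all? λ x → all? λ y → x · y ≟ y · x

  assoc? : Dec (Associative _≡_ _·_)
  assoc? = all? λ x → all? λ y → all? λ z → (x · y) · z ≟ x · (y · z)

  identityˡ? : Dec (LeftIdentity _≡_ 0F _·_)
  identityˡ? = all? λ x → 0F · x ≟ x

  fromLaws : Laws → IsCommutativeMonoid _≡_ _·_ 0F
  fromLaws (comm , assoc , identityˡ) = isCommutativeMonoidˡ record
    { isSemigroup = record { isMagma = isMagma _·_ ; assoc = assoc }
    ; identityˡ   = identityˡ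
    ; comm        = comm
    }

  toLaws : IsCommutativeMonoid _≡_ _·_ 0F → Laws
  toLaws isCM = comm , assoc , identityˡ
    where open IsCommutativeMonoid isCM

table : ∀ {n} → Vec (Vec (Fin n) n) n → Op₂ (Fin n)
table rows x y = lookup (lookup rows x) y

capped-+ : Op₂ (Fin 3)
capped-+ = table ( (0F ∷ 1F ∷ 2F ∷ [])
                 ∷ (1F ∷ 2F ∷ 2F ∷ [])
                 ∷ (2F ∷ 2F ∷ 2F ∷ []) ∷ [])

record FiniteMatrix (n : ℕ) : Set where
  field
    _·_ _⊓_ _⊔_           : Op₂ (Fin (suc n))
    designated            : Vec Bool (suc n)
    {isCommutativeMonoid} : True (isCommutativeMonoid? _·_)

  matrix : Matrix
  matrix = record
    { _·_                 = _·_
    ; ε                   = 0F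
    ; _⊓_                 = _⊓_
    ; _⊔_                 = _⊔_
    ; Designated          = T ∘ lookup designated
    ; isCommutativeMonoid = toWitness isCommutativeMonoid
    }

  designated? : ∀ x → Dec (T (lookup designated x))
  designated? = T? ∘ lookup designated

  validates? : ∀ r → Dec (Validates matrix r)
  validates? &R   = all? λ a → all? λ b → all? λ γ →
    designated? (a · γ) →-dec designated? (b · γ) →-dec designated? ((a ⊓ b) · γ)
  validates? ⊗R   = all? λ a → all? λ b → all? λ δ → all? λ θ →
    designated? (a · δ) →-dec designated? (b · θ) →-dec designated? ((a ⊓ b) · (δ · θ))
  validates? ⊕R   = all? λ a → all? λ b → all? λ γ →
    (designated? (a · γ) ⊎-dec designated? (b · γ)) →-dec designated? ((a ⊔ b) · γ)
  validates? parR = all? λ a → all? λ b → all? λ γ →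
    designated? (a · (b · γ)) →-dec designated? ((a ⊔ b) · γ)
  validates? WR   = all? λ a → all? λ γ → designated? γ →-dec designated? (a · γ)
  validates? CR   = all? λ a → all? λ γ → designated? (a · (a · γ)) →-dec designated? (a · γ)

  Validated : System
  Validated r = does (validates? r)

  validated⇒validates : ∀ {r} → Validated r ≡ true → Validates matrix r
  validated⇒validates {r} validated with validates? r
  ... | yes valid = valid

  validates-all-but : ∀ {S r₁ r₂} → (∀ r → Validated r ≡ false → r ≡ r₁ ⊎ r ≡ r₂)
                    → S r₁ ≡ false → S r₂ ≡ false → ∀ r → r ∈ˢ S → Validates matrix r
  validates-all-but exceptions r₁∉S r₂∉S r r∈S with Validated r in validated
  ... | true  = validated⇒validates validated
  ... | false with exceptions r validated
  ...   | inj₁ refl = contradiction r∈S (not-¬ r₁∉S)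
  ...   | inj₂ refl = contradiction r∈S (not-¬ r₂∉S)

open Matrix using (Designated)
open FiniteMatrix using (matrix)

record Countermodel (r₁ r₂ : Rule) : Set where
  field
    {n}             : ℕ
    finite          : FiniteMatrix n
  open FiniteMatrix finite using (Validated)
  field
    refutes-at-most : ∀ r → Validated r ≡ false → r ≡ r₁ ⊎ r ≡ r₂
    ι               : Literal → Fin (suc n)
  open Semantics (matrix finite) ι
  field
    axioms          : AxiomsDesignated
    tautology       : Formula
    valid           : Valid tautology
    refuted         : ¬ Designated (matrix finite) ⟦ tautology ∷ [] ⟧ˢ

necessary : ∀ {r₁ r₂ S} → Countermodel r₁ r₂ → Complete S → r₁ ∈ˢ S ⊎ r₂ ∈ˢ S
necessary {r₁} {r₂} {S} M complete with S r₁ in s₁ | S r₂ in s₂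
... | true  | _     = inj₁ refl
... | false | true  = inj₂ refl
... | false | false = ⊥-elim (refuted (sound (validates-all-but refutes-at-most s₁ s₂) axioms
                                         (complete tautology valid)))
  where
  open Countermodel M
  open FiniteMatrix finite using (validates-all-but)
  open Semantics (matrix finite) ι

-- Countermodels

P P̄ Q Q̄ : Formula
P  = lit (pos 0)
P̄  = lit (neg 0)
Q  = lit (pos 1)
Q̄  = lit (neg 1)

excluded-middle : Valid (P ∨ᶠ P̄)
excluded-middle v with v 0
... | true  = refl
... | false = refl

countermodel-&⊗ : Countermodel &R ⊗R
countermodel-&⊗ = record
  { finite = record
      { _·_ = table ( (0F ∷ 1F ∷ [])
                    ∷ (1F ∷ 1F ∷ []) ∷ [])
      ; _⊓_ = λ _ _ → 0F
      ; _⊔_ = table ( (0F ∷ 1F ∷ [])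
                    ∷ (1F ∷ 1F ∷ []) ∷ [])
      ; designated = false ∷ true ∷ []
      }
  ; refutes-at-most = λ { &R _ → inj₁ refl ; ⊗R _ → inj₂ refl ; ⊕R () ; parR () ; WR () ; CR () }
  ; ι = λ { (pos _) → 0F ; (neg _) → 1F }
  ; axioms = λ _ → _
  ; tautology = (P ∨ᶠ P̄) ∧ᶠ (P ∨ᶠ P̄)
  ; valid = λ v → cong₂ _∧_ (excluded-middle v) (excluded-middle v)
  ; refuted = λ ()
  }

countermodel-⊕par : Countermodel ⊕R parR
countermodel-⊕par = record
  { finite = record
      { _·_ = table ( (0F ∷ 1F ∷ [])
                    ∷ (1F ∷ 1F ∷ []) ∷ [])
      ; _⊓_ = table ( (0F ∷ 0F ∷ [])
                    ∷ (0F ∷ 1F ∷ []) ∷ [])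
      ; _⊔_ = λ _ _ → 0F
      ; designated = false ∷ true ∷ []
      }
  ; refutes-at-most = λ { ⊕R _ → inj₁ refl ; parR _ → inj₂ refl ; &R () ; ⊗R () ; WR () ; CR () }
  ; ι = λ { (pos _) → 0F ; (neg _) → 1F }
  ; axioms = λ _ → _
  ; tautology = P ∨ᶠ P̄
  ; valid = excluded-middle
  ; refuted = λ ()
  }

countermodel-Cpar : Countermodel CR parR
countermodel-Cpar = record
  { finite = record
      { _·_ = capped-+
      ; _⊓_ = table ( (0F ∷ 0F ∷ 0F ∷ [])
                    ∷ (0F ∷ 2F ∷ 2F ∷ [])
                    ∷ (0F ∷ 2F ∷ 2F ∷ []) ∷ [])
      ; _⊔_ = table ( (0F ∷ 2F ∷ 2F ∷ [])
                    ∷ (2F ∷ 1F ∷ 2F ∷ [])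
                    ∷ (2F ∷ 2F ∷ 2F ∷ []) ∷ [])
      ; designated = false ∷ false ∷ true ∷ []
      }
  ; refutes-at-most = λ { CR _ → inj₁ refl ; parR _ → inj₂ refl ; &R () ; ⊗R () ; ⊕R () ; WR () }
  ; ι = λ _ → 1F
  ; axioms = λ _ → _
  ; tautology = P ∨ᶠ P̄
  ; valid = excluded-middle
  ; refuted = λ ()
  }

countermodel-C& : Countermodel CR &R
countermodel-C& = record
  { finite = record
      { _·_ = capped-+
      ; _⊓_ = table ( (0F ∷ 0F ∷ 0F ∷ [])
                    ∷ (0F ∷ 0F ∷ 2F ∷ [])
                    ∷ (0F ∷ 2F ∷ 2F ∷ []) ∷ [])
      ; _⊔_ = table ( (0F ∷ 2F ∷ 2F ∷ [])
                    ∷ (1F ∷ 2F ∷ 2F ∷ [])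
                    ∷ (2F ∷ 2F ∷ 2F ∷ []) ∷ [])
      ; designated = false ∷ false ∷ true ∷ []
      }
  ; refutes-at-most = λ { CR _ → inj₁ refl ; &R _ → inj₂ refl ; ⊗R () ; ⊕R () ; parR () ; WR () }
  ; ι = λ _ → 1F
  ; axioms = λ _ → _
  ; tautology = P̄ ∨ᶠ (P ∧ᶠ P)
  ; valid = P̄∨P∧P-valid
  ; refuted = λ ()
  }
  where
  P̄∨P∧P-valid : Valid (P̄ ∨ᶠ (P ∧ᶠ P))
  P̄∨P∧P-valid v with v 0
  ... | true  = refl
  ... | false = refl

countermodel-W⊕ : Countermodel WR ⊕R
countermodel-W⊕ = record
  { finite = record
      { _·_ = table ( (0F ∷ 1F ∷ 2F ∷ [])
                    ∷ (1F ∷ 1F ∷ 1F ∷ [])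
                    ∷ (2F ∷ 1F ∷ 2F ∷ []) ∷ [])
      ; _⊓_ = table ( (0F ∷ 1F ∷ 0F ∷ [])
                    ∷ (1F ∷ 1F ∷ 0F ∷ [])
                    ∷ (0F ∷ 0F ∷ 0F ∷ []) ∷ [])
      ; _⊔_ = table ( (0F ∷ 1F ∷ 2F ∷ [])
                    ∷ (1F ∷ 1F ∷ 1F ∷ [])
                    ∷ (0F ∷ 1F ∷ 0F ∷ []) ∷ [])
      ; designated = true ∷ true ∷ false ∷ []
      }
  ; refutes-at-most = λ { WR _ → inj₁ refl ; ⊕R _ → inj₂ refl ; &R () ; ⊗R () ; parR () ; CR () }
  ; ι = λ { (pos 1) → 2F ; (neg 1) → 1F ; _ → 0F }
  ; axioms = λ { 0 → _ ; 1 → _ ; (suc (suc _)) → _ }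
  ; tautology = (P ∨ᶠ P̄) ∨ᶠ Q
  ; valid = λ v → cong₂ _∨_ (excluded-middle v) refl
  ; refuted = λ ()
  }

countermodel-W⊗ : Countermodel WR ⊗R
countermodel-W⊗ = record
  { finite = record
      { _·_ = table ( (0F ∷ 1F ∷ 2F ∷ 3F ∷ [])
                    ∷ (1F ∷ 1F ∷ 1F ∷ 1F ∷ [])
                    ∷ (2F ∷ 1F ∷ 2F ∷ 1F ∷ [])
                    ∷ (3F ∷ 1F ∷ 1F ∷ 3F ∷ []) ∷ [])
      ; _⊓_ = table ( (0F ∷ 0F ∷ 0F ∷ 0F ∷ [])
                    ∷ (0F ∷ 1F ∷ 1F ∷ 1F ∷ [])
                    ∷ (0F ∷ 1F ∷ 1F ∷ 0F ∷ [])
                    ∷ (2F ∷ 1F ∷ 0F ∷ 1F ∷ []) ∷ [])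
      ; _⊔_ = table ( (0F ∷ 1F ∷ 1F ∷ 1F ∷ [])
                    ∷ (1F ∷ 1F ∷ 1F ∷ 1F ∷ [])
                    ∷ (1F ∷ 1F ∷ 2F ∷ 1F ∷ [])
                    ∷ (1F ∷ 1F ∷ 1F ∷ 1F ∷ []) ∷ [])
      ; designated = true ∷ true ∷ false ∷ false ∷ []
      }
  ; refutes-at-most = λ { WR _ → inj₁ refl ; ⊗R _ → inj₂ refl ; &R () ; ⊕R () ; parR () ; CR () }
  ; ι = λ { (pos 1) → 0F ; (neg 1) → 0F ; (pos _) → 2F ; (neg _) → 3F }
  ; axioms = λ { 0 → _ ; 1 → _ ; (suc (suc _)) → _ }
  ; tautology = P ∨ᶠ (P̄ ∧ᶠ (Q ∨ᶠ Q̄))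
  ; valid = P∨P̄∧[Q∨Q̄]-valid
  ; refuted = λ ()
  }
  where
  P∨P̄∧[Q∨Q̄]-valid : Valid (P ∨ᶠ (P̄ ∧ᶠ (Q ∨ᶠ Q̄)))
  P∨P̄∧[Q∨Q̄]-valid v with v 0 | v 1
  ... | true  | _     = refl
  ... | false | true  = refl
  ... | false | false = refl

-- Under a valuation ⟦ A ⟧ is 0 exactly when A is false, so a sequent is designated exactly
-- when it is true; as · adds (capped at 2), a sequent split into two designated parts
-- needs two true formulas.
counting : FiniteMatrix 2
counting = record
  { _·_ = capped-+
  ; _⊓_ = table ( (0F ∷ 0F ∷ 0F ∷ [])
                ∷ (0F ∷ 1F ∷ 1F ∷ [])
                ∷ (0F ∷ 1F ∷ 2F ∷ []) ∷ [])
  ; _⊔_ = capped-+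
  ; designated = false ∷ true ∷ true ∷ []
  }

counting-validates : ∀ r → Validates (matrix counting) r
counting-validates r = FiniteMatrix.validated⇒validates counting (all-validated r)
  where
  all-validated : ∀ r → FiniteMatrix.Validated counting r ≡ true
  all-validated = λ { &R → refl ; ⊗R → refl ; ⊕R → refl ; parR → refl ; WR → refl ; CR → refl }

module Counting (v : ℕ → Bool) =
  Semantics (matrix counting) (λ l → if evalLit v l then 1F else 0F)

counting-sound : ∀ {S Γ} v → Der S (λ _ → ⊥) Γ → Designated (matrix counting) (Counting.⟦_⟧ˢ v Γ)
counting-sound v = Counting.sound v (λ r _ → counting-validates r) axioms
  where
  axioms : Counting.AxiomsDesignated v
  axioms n with v n
  ... | true  = _
  ... | false = _

designated-sum≢1 : ∀ x y → Designated (matrix counting) (capped-+ 0F x)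
                 → Designated (matrix counting) (capped-+ 0F y) → capped-+ x y ≢ 1F
designated-sum≢1 0F _  () _
designated-sum≢1 1F 0F _  ()
designated-sum≢1 2F 0F _  ()
designated-sum≢1 1F 1F _  _ ()
designated-sum≢1 1F 2F _  _ ()
designated-sum≢1 2F 1F _  _ ()
designated-sum≢1 2F 2F _  _ ()

-- Literals count 1 and compound formulas are absorbed into the designated 4, so in a system
-- without W and C a derivable sequent of literals has exactly two of them.
literal-counting : FiniteMatrix 4
literal-counting = record
  { _·_ = table ( (0F ∷ 1F ∷ 2F ∷ 3F ∷ 4F ∷ [])
                ∷ (1F ∷ 2F ∷ 3F ∷ 3F ∷ 4F ∷ [])
                ∷ (2F ∷ 3F ∷ 3F ∷ 3F ∷ 4F ∷ [])
                ∷ (3F ∷ 3F ∷ 3F ∷ 3F ∷ 4F ∷ [])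
                ∷ (4F ∷ 4F ∷ 4F ∷ 4F ∷ 4F ∷ []) ∷ [])
  ; _⊓_ = λ _ _ → 4F
  ; _⊔_ = λ _ _ → 4F
  ; designated = false ∷ false ∷ true ∷ false ∷ true ∷ []
  }

module LiteralCounting = Semantics (matrix literal-counting) (λ _ → 1F)

-- Without W and C the last rule of a derivation of P ∨ (Q ∨ G) is, up to permutation, a rule
-- for its principal formula; each branch ends in a premise refuted by one of the two
-- counting matrices.

G : Formula
G = P̄ ∧ᶠ (P̄ ∧ᶠ Q̄)

∨∉G,P,Q : ∀ {A B} → (A ∨ᶠ B) ∉ G ∷ P ∷ Q ∷ []
∨∉G,P,Q (here ())
∨∉G,P,Q (there (here ()))
∨∉G,P,Q (there (there (here ())))
∨∉G,P,Q (there (there (there ())))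

∧∉Q∨G,P : ∀ {A B} → (A ∧ᶠ B) ∉ (Q ∨ᶠ G) ∷ P ∷ []
∧∉Q∨G,P (here ())
∧∉Q∨G,P (there (here ()))
∧∉Q∨G,P (there (there ()))

module _ {S : System} (W∉S : S WR ≡ false) (C∉S : S CR ≡ false) where

  literal-count-designated : ∀ {Γ Δ} → Der S (λ _ → ⊥) Γ → Γ ↭ Δ
                           → Designated (matrix literal-counting) LiteralCounting.⟦ Δ ⟧ˢ
  literal-count-designated d Γ↭Δ =
    subst (Designated (matrix literal-counting)) (LiteralCounting.⟦⟧ˢ-↭ Γ↭Δ)
      (LiteralCounting.sound validates (λ _ → _) d)
    where
    validates : ∀ r → r ∈ˢ S → Validates (matrix literal-counting) r
    validates = FiniteMatrix.validates-all-but literal-counting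
      (λ { WR _ → inj₁ refl ; CR _ → inj₂ refl ; &R () ; ⊗R () ; ⊕R () ; parR () }) W∉S C∉S

  G,P,Q-underivable : ∀ {Γ} → Der S (λ _ → ⊥) Γ → Γ ↭ G ∷ P ∷ Q ∷ [] → ⊥
  G,P,Q-underivable (leaf ())
  G,P,Q-underivable (perm Γ↭Δ d) Δ↭ = G,P,Q-underivable d (↭-trans Γ↭Δ Δ↭)
  G,P,Q-underivable (ax _) ↭G,P,Q = case ↭-length ↭G,P,Q of λ ()
  G,P,Q-underivable (with& _ d _) ↭G,P,Q with ∈-resp-↭ ↭G,P,Q (here refl)
  ... | here refl = literal-count-designated d (prep P̄ (drop-∷ ↭G,P,Q))
  ... | there (here ())
  ... | there (there (here ()))
  ... | there (there (there ()))
  -- With only P true, each premise needs a true formula in its part of the context, but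
  -- Δ ++ Θ ↭ P , Q has only one.
  G,P,Q-underivable (with⊗ _ {Δ} {Θ} d₁ d₂) ↭G,P,Q with ∈-resp-↭ ↭G,P,Q (here refl)
  ... | here refl = designated-sum≢1 ⟦ Δ ⟧ˢ ⟦ Θ ⟧ˢ (counting-sound (_≡ᵇ 0) d₁) (counting-sound (_≡ᵇ 0) d₂)
                      (trans (sym (⟦⟧ˢ-++ Δ Θ)) (⟦⟧ˢ-↭ (drop-∷ ↭G,P,Q)))
    where open Counting (_≡ᵇ 0)
  ... | there (here ())
  ... | there (there (here ()))
  ... | there (there (there ()))
  G,P,Q-underivable (with⊕₁ _ _)  ↭G,P,Q = ∨∉G,P,Q (∈-resp-↭ ↭G,P,Q (here refl))
  G,P,Q-underivable (with⊕₂ _ _)  ↭G,P,Q = ∨∉G,P,Q (∈-resp-↭ ↭G,P,Q (here refl))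
  G,P,Q-underivable (withPar _ _) ↭G,P,Q = ∨∉G,P,Q (∈-resp-↭ ↭G,P,Q (here refl))
  G,P,Q-underivable (withW W∈S _ _) _   = contradiction W∈S (not-¬ W∉S)
  G,P,Q-underivable (withC C∈S _)   _   = contradiction C∈S (not-¬ C∉S)

  Q∨G,P-underivable : ∀ {Γ} → Der S (λ _ → ⊥) Γ → Γ ↭ (Q ∨ᶠ G) ∷ P ∷ [] → ⊥
  Q∨G,P-underivable (leaf ())
  Q∨G,P-underivable (perm Γ↭Δ d) Δ↭ = Q∨G,P-underivable d (↭-trans Γ↭Δ Δ↭)
  Q∨G,P-underivable (ax _) ↭Q∨G,P with ∈-resp-↭ (↭-sym ↭Q∨G,P) (here refl)
  ... | here ()
  ... | there (here ())
  ... | there (there ())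
  Q∨G,P-underivable (with& _ _ _) ↭Q∨G,P = ∧∉Q∨G,P (∈-resp-↭ ↭Q∨G,P (here refl))
  Q∨G,P-underivable (with⊗ _ _ _) ↭Q∨G,P = ∧∉Q∨G,P (∈-resp-↭ ↭Q∨G,P (here refl))
  Q∨G,P-underivable (with⊕₁ _ d) ↭Q∨G,P with ∈-resp-↭ ↭Q∨G,P (here refl)
  ... | here refl = counting-sound (λ _ → false) (perm (prep Q (drop-∷ ↭Q∨G,P)) d)
  ... | there (here ())
  ... | there (there ())
  Q∨G,P-underivable (with⊕₂ _ d) ↭Q∨G,P with ∈-resp-↭ ↭Q∨G,P (here refl)
  ... | here refl = counting-sound (_≡ᵇ 1) (perm (prep G (drop-∷ ↭Q∨G,P)) d)
  ... | there (here ())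
  ... | there (there ())
  Q∨G,P-underivable (withPar _ d) ↭Q∨G,P with ∈-resp-↭ ↭Q∨G,P (here refl)
  ... | here refl = G,P,Q-underivable d (↭-trans (prep Q (prep G (drop-∷ ↭Q∨G,P)))
                                                 (↭-trans (swap Q G ↭-refl) (prep G (swap Q P ↭-refl))))
  ... | there (here ())
  ... | there (there ())
  Q∨G,P-underivable (withW W∈S _ _) _ = contradiction W∈S (not-¬ W∉S)
  Q∨G,P-underivable (withC C∈S _)   _ = contradiction C∈S (not-¬ C∉S)

  P∨[Q∨G]-underivable : ∀ {Γ} → Der S (λ _ → ⊥) Γ → Γ ↭ (P ∨ᶠ (Q ∨ᶠ G)) ∷ [] → ⊥
  P∨[Q∨G]-underivable (leaf ())
  P∨[Q∨G]-underivable (perm Γ↭Δ d) Δ↭ = P∨[Q∨G]-underivable d (↭-trans Γ↭Δ Δ↭)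
  P∨[Q∨G]-underivable (ax _) ↭F = case ↭-length ↭F of λ ()
  P∨[Q∨G]-underivable (with& _ _ _) ↭F = case ∈-resp-↭ ↭F (here refl) of λ { (here ()) ; (there ()) }
  P∨[Q∨G]-underivable (with⊗ _ _ _) ↭F = case ∈-resp-↭ ↭F (here refl) of λ { (here ()) ; (there ()) }
  P∨[Q∨G]-underivable (with⊕₁ _ d) ↭F with ∈-resp-↭ ↭F (here refl)
  ... | here refl = counting-sound (λ _ → false) (perm (prep P (drop-∷ ↭F)) d)
  ... | there ()
  P∨[Q∨G]-underivable (with⊕₂ _ d) ↭F with ∈-resp-↭ ↭F (here refl)
  ... | here refl = counting-sound (_≡ᵇ 0) (perm (prep (Q ∨ᶠ G) (drop-∷ ↭F)) d)
  ... | there ()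
  P∨[Q∨G]-underivable (withPar _ d) ↭F with ∈-resp-↭ ↭F (here refl)
  ... | here refl = Q∨G,P-underivable d (swap P (Q ∨ᶠ G) (drop-∷ ↭F))
  ... | there ()
  P∨[Q∨G]-underivable (withW W∈S _ _) _ = contradiction W∈S (not-¬ W∉S)
  P∨[Q∨G]-underivable (withC C∈S _)   _ = contradiction C∈S (not-¬ C∉S)

W⊎C-necessary : ∀ {S} → Complete S → WR ∈ˢ S ⊎ CR ∈ˢ S
W⊎C-necessary {S} complete with S WR in w | S CR in c
... | true  | _     = inj₁ refl
... | false | true  = inj₂ refl
... | false | false = ⊥-elim (P∨[Q∨G]-underivable w c (complete _ P∨[Q∨G]-valid) ↭-refl)
  where
  P∨[Q∨G]-valid : Valid (P ∨ᶠ (Q ∨ᶠ G))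
  P∨[Q∨G]-valid v with v 0 | v 1
  ... | true  | _     = refl
  ... | false | true  = refl
  ... | false | false = refl

-- Completeness

ValidSequent : Sequent → Set
ValidSequent Γ = ∀ v → Any (T ∘ eval v) Γ

valid-singleton : ∀ {A} → Valid A → ValidSequent (A ∷ [])
valid-singleton A-valid v = here (Equivalence.from T-≡ (A-valid v))

valid-↭ : ∀ {Γ Δ} → Γ ↭ Δ → ValidSequent Γ → ValidSequent Δ
valid-↭ Γ↭Δ valid v = Any-resp-↭ Γ↭Δ (valid v)

valid-∧ˡ : ∀ {A B Γ} → ValidSequent ((A ∧ᶠ B) ∷ Γ) → ValidSequent (A ∷ Γ)
valid-∧ˡ valid v with valid v
... | here  A∧B-true = here (proj₁ (Equivalence.to T-∧ A∧B-true))
... | there Γ-true   = there Γ-true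

valid-∧ʳ : ∀ {A B Γ} → ValidSequent ((A ∧ᶠ B) ∷ Γ) → ValidSequent (B ∷ Γ)
valid-∧ʳ valid v with valid v
... | here  A∧B-true = here (proj₂ (Equivalence.to T-∧ A∧B-true))
... | there Γ-true   = there Γ-true

valid-∨ : ∀ {A B Γ} → ValidSequent ((A ∨ᶠ B) ∷ Γ) → ValidSequent (A ∷ B ∷ Γ)
valid-∨ valid v with valid v
... | here  A∨B-true = [ here , there ∘ here ]′ (Equivalence.to T-∨ A∨B-true)
... | there Γ-true   = there (there Γ-true)

-- The valuation making true exactly the atoms with a negative occurrence falsifies every
-- negative literal, so the literal it makes true is a P whose P̄ occurs.
complementary-pair : ∀ ls → ValidSequent (map lit ls) → ∃ λ n → pos n ∈ ls × neg n ∈ ls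
complementary-pair ls valid = pair (find (Any.map⁻ (valid negated)))
  where
  negated : ℕ → Bool
  negated n = does (neg n ∈ˡ? ls)

  pair : ∃ (λ l → l ∈ ls × T (evalLit negated l)) → ∃ λ n → pos n ∈ ls × neg n ∈ ls
  pair (pos n , pos∈ls , holds) with neg n ∈ˡ? ls
  ... | yes neg∈ls = n , pos∈ls , neg∈ls
  ... | no  _      = ⊥-elim holds
  pair (neg n , neg∈ls , holds) with neg n ∈ˡ? ls
  ... | yes _      = ⊥-elim holds
  ... | no  neg∉ls = contradiction neg∈ls neg∉ls

size : Formula → ℕ
size (lit _)   = 1
size (A ∧ᶠ B) = suc (size A + size B)
size (A ∨ᶠ B) = suc (size A + size B)

sizeˢ : Sequent → ℕ
sizeˢ []      = 0
sizeˢ (A ∷ Γ) = size A + sizeˢ Γ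

module _ (Φ : Sequent → Set)
         (Φ-↭     : ∀ {Γ Δ} → Γ ↭ Δ → Φ Γ → Φ Δ)
         (Φ-axiom : ∀ {n Γ} → lit (pos n) ∈ Γ → lit (neg n) ∈ Γ → Φ Γ)
         (Φ-∧     : ∀ {A B Γ} → Φ (A ∷ Γ) → Φ (B ∷ Γ) → Φ ((A ∧ᶠ B) ∷ Γ))
         (Φ-∨     : ∀ {A B Γ} → Φ (A ∷ B ∷ Γ) → Φ ((A ∨ᶠ B) ∷ Γ)) where

  private
    decompose : ∀ Γ ls → Acc (_<_ on sizeˢ) Γ → ValidSequent (Γ ++ map lit ls) → Φ (Γ ++ map lit ls)
    decompose [] ls _ valid with complementary-pair ls valid
    ... | _ , pos∈ls , neg∈ls = Φ-axiom (∈-map⁺ lit pos∈ls) (∈-map⁺ lit neg∈ls)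
    decompose (lit l ∷ Γ) ls (acc smaller) valid =
      Φ-↭ (shift (lit l) Γ (map lit ls))
        (decompose Γ (l ∷ ls) (smaller ≤-refl) (valid-↭ (↭-sym (shift (lit l) Γ (map lit ls))) valid))
    decompose ((A ∧ᶠ B) ∷ Γ) ls (acc smaller) valid =
      Φ-∧ (decompose (A ∷ Γ) ls (smaller (s≤s (+-monoˡ-≤ (sizeˢ Γ) (m≤m+n (size A) (size B)))))
                     (valid-∧ˡ valid))
          (decompose (B ∷ Γ) ls (smaller (s≤s (+-monoˡ-≤ (sizeˢ Γ) (m≤n+m (size B) (size A)))))
                     (valid-∧ʳ valid))
    decompose ((A ∨ᶠ B) ∷ Γ) ls (acc smaller) valid =
      Φ-∨ (decompose (A ∷ B ∷ Γ) ls (smaller (s≤s (≤-reflexive (sym (+-assoc (size A) (size B) (sizeˢ Γ))))))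
                     (valid-∨ valid))

  valid⇒Φ : ∀ {Γ} → ValidSequent Γ → Φ Γ
  valid⇒Φ {Γ} valid = Φ-↭ (↭-reflexive (++-identityʳ Γ))
    (decompose Γ [] (on-wellFounded sizeˢ <-wellFounded Γ)
      (valid-↭ (↭-reflexive (sym (++-identityʳ Γ))) valid))

complete-with-W : ∀ {S} → WR ∈ˢ S
  → (∀ {A B Γ} → Der S (λ _ → ⊥) (A ∷ Γ) → Der S (λ _ → ⊥) (B ∷ Γ) → Der S (λ _ → ⊥) ((A ∧ᶠ B) ∷ Γ))
  → (∀ {A B Γ} → Der S (λ _ → ⊥) (A ∷ B ∷ Γ) → Der S (λ _ → ⊥) ((A ∨ᶠ B) ∷ Γ))
  → Complete S
complete-with-W {S} W∈S &-admissible par-admissible A A-valid =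
  valid⇒Φ (Der S (λ _ → ⊥)) perm (axiom-weakened W∈S) &-admissible par-admissible (valid-singleton A-valid)

GS1p-complete : Complete GS1p
GS1p-complete = complete-with-W refl (with& refl) (par-by-⊕C refl refl)

Np-complete : Complete Np
Np-complete = complete-with-W refl (with& refl) (withPar refl)

module _ {S : System} (⊗∈S : ⊗R ∈ˢ S) (⊕∈S : ⊕R ∈ˢ S) (C∈S : CR ∈ˢ S) where

  SubDerivable : Sequent → Set
  SubDerivable Γ = ∃ λ Γ₀ → Der S (λ _ → ⊥) Γ₀ × Γ₀ ⊆ Γ

  private
    drop-head : ∀ {A C : Formula} {Γ} → C ∈ A ∷ Γ → C ≢ A → C ∈ Γ
    drop-head (here C≡A)  C≢A = contradiction C≡A C≢A
    drop-head (there C∈Γ) _   = C∈Γ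

    subDerivable-↭ : ∀ {Γ Δ} → Γ ↭ Δ → SubDerivable Γ → SubDerivable Δ
    subDerivable-↭ Γ↭Δ (Ξ , d , Ξ⊆) = Ξ , d , ∈-resp-↭ Γ↭Δ ∘ Ξ⊆

    subDerivable-axiom : ∀ {n Γ} → lit (pos n) ∈ Γ → lit (neg n) ∈ Γ → SubDerivable Γ
    subDerivable-axiom pos∈Γ neg∈Γ = _ , ax _ , λ { (here refl) → pos∈Γ ; (there (here refl)) → neg∈Γ }

    ⊕-into : ∀ {A B Γ C Δ} → C ∈ A ∷ B ∷ Γ → Der S (λ _ → ⊥) (C ∷ Δ)
           → ∃ λ C′ → C′ ∈ (A ∨ᶠ B) ∷ Γ × Der S (λ _ → ⊥) (C′ ∷ Δ)
    ⊕-into (here refl)         d = _ , here refl , with⊕₁ ⊕∈S d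
    ⊕-into (there (here refl)) d = _ , here refl , with⊕₂ ⊕∈S d
    ⊕-into (there (there C∈Γ)) d = _ , there C∈Γ , d

    lift-∨ : ∀ {A B Γ} Ξ Θ → Ξ ⊆ A ∷ B ∷ Γ → Θ ⊆ (A ∨ᶠ B) ∷ Γ → Der S (λ _ → ⊥) (Ξ ++ Θ)
           → SubDerivable ((A ∨ᶠ B) ∷ Γ)
    lift-∨ []      Θ _  Θ⊆ d = Θ , d , Θ⊆
    lift-∨ (C ∷ Ξ) Θ Ξ⊆ Θ⊆ d with ⊕-into (Ξ⊆ (here refl)) d
    ... | C′ , C′∈ , d′ = lift-∨ Ξ (C′ ∷ Θ) (Ξ⊆ ∘ there) C′∷Θ⊆ (perm (↭-sym (shift C′ Ξ Θ)) d′)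
      where
      C′∷Θ⊆ : C′ ∷ Θ ⊆ _
      C′∷Θ⊆ (here refl) = C′∈
      C′∷Θ⊆ (there C∈Θ) = Θ⊆ C∈Θ

    ∨-step : ∀ {A B Γ} → SubDerivable (A ∷ B ∷ Γ) → SubDerivable ((A ∨ᶠ B) ∷ Γ)
    ∨-step (Ξ , d , Ξ⊆) = lift-∨ Ξ [] Ξ⊆ (λ ()) (perm (↭-sym (↭-++-identityʳ Ξ)) d)

    split-head : ∀ {A Γ} → SubDerivable (A ∷ Γ)
               → SubDerivable Γ ⊎ ∃ λ Δ → Der S (λ _ → ⊥) (A ∷ Δ) × Δ ⊆ Γ
    split-head {A} (Ξ , d , Ξ⊆) with A ∈ᶠ? Ξ
    ... | no  A∉Ξ = inj₁ (Ξ , d , λ C∈Ξ → drop-head (Ξ⊆ C∈Ξ) λ { refl → A∉Ξ C∈Ξ })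
    ... | yes A∈Ξ = inj₂ (Ξ ∖ A , isolate C∈S A∈Ξ d ,
                          λ C∈Ξ∖A → let C∈Ξ , C≢A = ∈-filter⁻ _ C∈Ξ∖A in drop-head (Ξ⊆ C∈Ξ) C≢A)

    ∧-step : ∀ {A B Γ} → SubDerivable (A ∷ Γ) → SubDerivable (B ∷ Γ) → SubDerivable ((A ∧ᶠ B) ∷ Γ)
    ∧-step {A} {B} {Γ} left right with split-head left | split-head right
    ... | inj₁ (Ξ , d , Ξ⊆)  | _                  = Ξ , d , there ∘ Ξ⊆
    ... | inj₂ _             | inj₁ (Ξ , d , Ξ⊆)  = Ξ , d , there ∘ Ξ⊆
    ... | inj₂ (Δ , dA , Δ⊆) | inj₂ (Θ , dB , Θ⊆) = (A ∧ᶠ B) ∷ Δ ++ Θ , with⊗ ⊗∈S dA dB , ⊆A∧B∷Γ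
      where
      ⊆A∧B∷Γ : (A ∧ᶠ B) ∷ Δ ++ Θ ⊆ (A ∧ᶠ B) ∷ Γ
      ⊆A∧B∷Γ (here refl)     = here refl
      ⊆A∧B∷Γ (there C∈Δ++Θ) = there ([ Δ⊆ , Θ⊆ ]′ (∈-++⁻ Δ C∈Δ++Θ))

  complete-⊗⊕C : Complete S
  complete-⊗⊕C A A-valid
    with split-head (valid⇒Φ SubDerivable subDerivable-↭ subDerivable-axiom ∧-step ∨-step
                               (valid-singleton A-valid))
  ... | inj₁ (Ξ , d , Ξ⊆[]) = ⊥-elim (counting-sound (λ _ → false) (subst (Der S _) (⊆[]⇒≡[] Ξ⊆[]) d))
  ... | inj₂ (Δ , d , Δ⊆[]) = subst (λ Δ → Der S _ (A ∷ Δ)) (⊆[]⇒≡[] Δ⊆[]) d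

Pp-complete : Complete Pp
Pp-complete = complete-⊗⊕C refl refl refl

resolve : ∀ {A B : Set} → A ⊎ B → ¬ A → B
resolve A⊎B ¬A = fromInj₂ (λ A → contradiction A ¬A) A⊎B

classification : ∀ S → Complete S → Equivalent S GS1p ⊎ Equivalent S Pp ⊎ Equivalent S Np
classification S complete with S WR in w | S CR in c
... | true  | true  = inj₁ ( contains-GS1p w c (necessary countermodel-&⊗ complete)
                                             (necessary countermodel-⊕par complete)
                           , GS1p-contains S)
... | false | true  = inj₂ (inj₁ ( contains-Pp (resolve (necessary countermodel-W⊗ complete) (not-¬ w))
                                                (resolve (necessary countermodel-W⊕ complete) (not-¬ w)) c
                                 , Pp-contains (not-¬ w)))
... | true  | false = inj₂ (inj₂ ( contains-Np (resolve (necessary countermodel-C& complete) (not-¬ c))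
                                                (resolve (necessary countermodel-Cpar complete) (not-¬ c)) w
                                 , Np-contains (not-¬ c)))
... | false | false = contradiction₂ (W⊎C-necessary complete) (not-¬ w) (not-¬ c)

theorem19 : (Complete GS1p × Complete Pp × Complete Np)
    × (∀ (S : System) → Complete S
       → Equivalent S GS1p ⊎ Equivalent S Pp ⊎ Equivalent S Np)
theorem19 = (GS1p-complete , Pp-complete , Np-complete) , classification
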